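{- Let $\Gamma$ be a group, $g$ a positive integer, $\pi\in\Gamma$, and let $A\subseteq\Gamma$ have the property that for every $\mu\in\Gamma$, $$|\{\alpha\in A:\alpha\pi\alpha^{ -1}=\mu\}|\le g.$$ Then $\{(\alpha,\alpha\pi):\alpha\in A\}$ is an $S_2[g]$-set in $\Gamma\times\Gamma$.
   Context: For a group $\Gamma$, a set $A\subseteq\Gamma$ is an $S_2[g]$-set if for every $\mu\in\Gamma$ there are at most $g$ pairs $(\alpha_1,\alpha_2)\in A^2$ with $\alpha_1\alpha_2=\mu$. -}

module Defs where

open import Level using (Level; _⊔_)
open import Data.Nat using (ℕ; _≤_)
open import Data.List using (List; length)
open import Data.List.Relation.Unary.All using (All)
open import Data.Product using (_×_; _,_; Σ-syntax)
open import Data.Product.Relation.Binary.Pointwise.NonDependent using (×-setoid)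
open import Relation.Unary using (Pred)
open import Relation.Binary.Bundles using (Setoid)
open import Algebra.Bundles using (Group)
open import Algebra.Construct.DirectProduct using (group)
import Data.List.Relation.Unary.Unique.Setoid as UniqueS

private variable
  a ℓ p c : Level

-- This is the classical |{x : P x}| ≤ g, and makes
-- sense for arbitrary (possibly infinite) ambient sets.
AtMost : (S : Setoid a ℓ) → ℕ → Pred (Setoid.Carrier S) p → Set (a ⊔ ℓ ⊔ p)
AtMost S g P = (xs : List (Setoid.Carrier S)) → UniqueS.Unique S xs → All P xs → length xs ≤ g

S₂[_] : (Γ : Group c ℓ) → ℕ → Pred (Group.Carrier Γ) p → Set (c ⊔ ℓ ⊔ p)
S₂[ Γ ] g A = ∀ μ → AtMost (×-setoid setoid setoid) g
                 (λ { (α₁ , α₂) → A α₁ × A α₂ × (α₁ ∙ α₂) ≈ μ })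
  where open Group Γ

_×G_ : Group c ℓ → Group c ℓ → Group c ℓ
Γ ×G Δ = group Γ Δ

graphSet : (Γ : Group c ℓ) → Group.Carrier Γ → Pred (Group.Carrier Γ) p →
           Pred (Group.Carrier Γ × Group.Carrier Γ) (c ⊔ ℓ ⊔ p)
graphSet Γ π A (x , y) = Σ[ α ∈ Carrier ] (A α × x ≈ α × y ≈ (α ∙ π))
  where open Group Γ

{-# OPTIONS --safe #-}
-- A factorisation (α , απ)(β , βπ) = (μ₁ , μ₂) in Γ × Γ forces β = α⁻¹μ₁,
-- hence απα⁻¹ = μ₂π⁻¹μ₁⁻¹: each factorisation yields an α ∈ A conjugating π
-- to one fixed element.  Distinct factorisations yield distinct α, since the
-- left factor (α , απ) and the product determine the right factor.
module Submission where

open import Defs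
open import Level using (Level)
open import Data.Nat using (ℕ; suc; _≤_)
open import Data.List using ([]; _∷_; length)
open import Data.List.Relation.Unary.All using (All; []; _∷_; reduce)
open import Data.List.Relation.Unary.AllPairs using ([]; _∷_)
open import Data.Product using (_×_; _,_; proj₁)
open import Data.Product.Relation.Binary.Pointwise.NonDependent using (×-setoid)
open import Relation.Nullary using (¬_)
open import Relation.Unary using (Pred)
open import Relation.Binary.Bundles using (Setoid)
open import Relation.Binary.PropositionalEquality using (_≡_; refl; cong; subst)
open import Algebra.Bundles using (Group)
import Algebra.Properties.Group as GroupProperties
import Data.List.Relation.Unary.Unique.Setoid as UniqueS

module _ {a b ℓ₁ ℓ₂ p q : Level} (S : Setoid a ℓ₁) (T : Setoid b ℓ₂)
         {P : Pred (Setoid.Carrier S) p} {Q : Pred (Setoid.Carrier T) q}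
         (f : ∀ {x} → P x → Setoid.Carrier T)
         (f-sound : ∀ {x} (px : P x) → Q (f px))
         (f-injective : ∀ {x y} (px : P x) (py : P y) →
                        Setoid._≈_ T (f px) (f py) → Setoid._≈_ S x y)
         where
  private
    module S = Setoid S
    module T = Setoid T

  length-reduce : ∀ {xs} (pxs : All P xs) → length (reduce f pxs) ≡ length xs
  length-reduce []        = refl
  length-reduce (_ ∷ pxs) = cong suc (length-reduce pxs)

  All-reduce : ∀ {xs} (pxs : All P xs) → All Q (reduce f pxs)
  All-reduce []         = []
  All-reduce (px ∷ pxs) = f-sound px ∷ All-reduce pxs

  Unique-reduce : ∀ {xs} → UniqueS.Unique S xs → (pxs : All P xs) →
                  UniqueS.Unique T (reduce f pxs)
  Unique-reduce         []           []         = []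
  Unique-reduce {x ∷ _} (x≉xs ∷ xs!) (px ∷ pxs) = distinct x≉xs pxs ∷ Unique-reduce xs! pxs
    where
    distinct : ∀ {ys} → All (λ y → ¬ x S.≈ y) ys → (pys : All P ys) →
               All (λ z → ¬ f px T.≈ z) (reduce f pys)
    distinct []            []         = []
    distinct (x≉y ∷ x≉ys) (py ∷ pys) =
      (λ fx≈fy → x≉y (f-injective px py fx≈fy)) ∷ distinct x≉ys pys

  AtMost-injection : ∀ {g} → AtMost T g Q → AtMost S g P
  AtMost-injection bound xs xs! pxs =
    subst (_≤ _) (length-reduce pxs)
          (bound (reduce f pxs) (Unique-reduce xs! pxs) (All-reduce pxs))

module _ {c ℓ : Level} (G : Group c ℓ) where
  open Group G
  open GroupProperties G using (x≈z//y; y≈x\\z)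
  open import Relation.Binary.Reasoning.Setoid setoid

  conjugate-from-graph-product : ∀ {α β π μ₁ μ₂} → α ∙ β ≈ μ₁ → (α ∙ π) ∙ (β ∙ π) ≈ μ₂ →
                                 (α ∙ π) ∙ α ⁻¹ ≈ (μ₂ // π) // μ₁
  conjugate-from-graph-product {α} {β} {π} {μ₁} {μ₂} αβ≈μ₁ αβπ≈μ₂ = x≈z//y _ μ₁ _ (begin
    (α ∙ π) ∙ α ⁻¹ ∙ μ₁    ≈⟨ assoc (α ∙ π) (α ⁻¹) μ₁ ⟩
    (α ∙ π) ∙ (α \\ μ₁)   ≈⟨ ∙-congˡ (y≈x\\z α β μ₁ αβ≈μ₁) ⟨
    (α ∙ π) ∙ β           ≈⟨ x≈z//y _ π μ₂ (trans (assoc (α ∙ π) β π) αβπ≈μ₂) ⟩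
    μ₂ // π               ∎)

module _ {c ℓ p : Level} (Γ : Group c ℓ) (π : Group.Carrier Γ) (A : Pred (Group.Carrier Γ) p) where
  open Group Γ
  private
    module Γ² = Group (Γ ×G Γ)
  open GroupProperties (Γ ×G Γ) using (∙-cancelˡ)

  IsFactorisation : Γ².Carrier → Pred (Γ².Carrier × Γ².Carrier) _
  IsFactorisation μ (u , v) = graphSet Γ π A u × graphSet Γ π A v × u Γ².∙ v Γ².≈ μ

  graphSet-witness-injective : ∀ {u u'} (gu : graphSet Γ π A u) (gu' : graphSet Γ π A u') →
            proj₁ gu ≈ proj₁ gu' → u Γ².≈ u'
  graphSet-witness-injective (α , _ , x≈α , y≈απ) (α' , _ , x'≈α' , y'≈α'π) α≈α' =
    trans x≈α (trans α≈α' (sym x'≈α')) , trans y≈απ (trans (∙-congʳ α≈α') (sym y'≈α'π))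

  factorisation-witness : ∀ {μ r} → IsFactorisation μ r → Carrier
  factorisation-witness ((α , _) , _) = α

  factorisation-witness-conjugates : ∀ {μ₁ μ₂ r} (fr : IsFactorisation (μ₁ , μ₂) r) →
    let α = factorisation-witness fr in A α × (α ∙ π) ∙ α ⁻¹ ≈ (μ₂ // π) // μ₁
  factorisation-witness-conjugates
    ((α , Aα , x₁≈α , y₁≈απ) , (β , _ , x₂≈β , y₂≈βπ) , x₁x₂≈μ₁ , y₁y₂≈μ₂) =
    Aα , conjugate-from-graph-product Γ (trans (∙-cong (sym x₁≈α) (sym x₂≈β)) x₁x₂≈μ₁)
                                        (trans (∙-cong (sym y₁≈απ) (sym y₂≈βπ)) y₁y₂≈μ₂)

  factorisation-witness-injective : ∀ {μ r r'} (fr : IsFactorisation μ r)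
                                    (fr' : IsFactorisation μ r') →
    factorisation-witness fr ≈ factorisation-witness fr' →
    Setoid._≈_ (×-setoid Γ².setoid Γ².setoid) r r'
  factorisation-witness-injective {r = u , v} {u' , v'} (gu , _ , uv≈μ) (gu' , _ , u'v'≈μ) α≈α' =
    u≈u' , ∙-cancelˡ u v v'
             (Γ².trans uv≈μ (Γ².trans (Γ².sym u'v'≈μ) (Γ².∙-congʳ (Γ².sym u≈u'))))
    where
    u≈u' : u Γ².≈ u'
    u≈u' = graphSet-witness-injective gu gu' α≈α'

proposition4p1 : ∀ {c ℓ p : Level} (Γ : Group c ℓ) (g : ℕ) → 1 ≤ g →
    (π : Group.Carrier Γ) (A : Pred (Group.Carrier Γ) p) →
    (∀ μ → AtMost (Group.setoid Γ) g
             (λ α → A α × Group._≈_ Γ (Group._∙_ Γ (Group._∙_ Γ α π) (Group._⁻¹ Γ α)) μ)) →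
    S₂[ Γ ×G Γ ] g (graphSet Γ π A)
proposition4p1 Γ _ _ π A bound (μ₁ , μ₂) =
  AtMost-injection (×-setoid Γ².setoid Γ².setoid) setoid
    (factorisation-witness Γ π A)
    (factorisation-witness-conjugates Γ π A)
    (factorisation-witness-injective Γ π A)
    (bound ((μ₂ // π) // μ₁))
  where
  open Group Γ
  module Γ² = Group (Γ ×G Γ)
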